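{- For every integer $n\ge 3$, $C_2(C_n\circledcirc K_1)=n$.
   Context: Irreversible $k$-threshold process on a finite simple graph $G=(V,E)$: start with a set $S_0\subseteq V$ of colored vertices; for $t\ge1$, $S_t$ consists of $S_{t-1}$ together with every vertex having at least $k$ neighbors in $S_{t-1}$. $S_0$ is an irreversible $k$-threshold conversion set if $S_t=V$ for some $t\ge 0$. $C_k(G)$ is the minimum size of such a set. Double corona product $C_n\circledcirc K_p$: its vertices are $v_1,\dots,v_n$, $w_1,\dots,w_n$ and $u_i^j$ ($1\le i\le n$, $1\le j\le p$). Edges: $v_1\cdots v_n$ forms a cycle; $w_1\cdots w_n$ forms a second cycle; for each $i$ the vertices $u_i^1,\dots,u_i^p$ form a complete graph $K_p$; and for each $i$, both $v_i$ and $w_i$ are joined to every $u_i^j$. No other edges. For $p=1$ each $i$ gives one vertex $u_i^1$ adjacent to $v_i$ and $w_i$. -}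

module Defs where

open import Data.Nat using (ℕ; zero; suc; _+_; _*_; _≤_; _≤ᵇ_; _≡ᵇ_)
open import Data.Bool using (Bool; true; false; _∧_; _∨_; if_then_else_)
open import Data.Fin using (Fin; toℕ; remQuot)
open import Data.List using (List; map)
open import Data.Nat.ListAction using (sum)
open import Data.Fin.Base using () renaming (zero to f0; suc to fs)
open import Data.List using (allFin)
open import Data.Product using (Σ; _×_; _,_; ∃)
open import Relation.Binary.PropositionalEquality using (_≡_)

-- Finite simple graphs on vertex set Fin N, given by a Boolean
-- adjacency function (assumed symmetric and irreflexive).

record Graph : Set where
  constructor mkGraph
  field
    order : ℕ
    adj   : Fin order → Fin order → Bool
open Graph public

VSet : Graph → Set
VSet G = Fin (order G) → Bool

count : ∀ {N} → (Fin N → Bool) → ℕ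
count {N} f = sum (map (λ x → if f x then 1 else 0) (allFin N))

nbrsIn : (G : Graph) → VSet G → Fin (order G) → ℕ
nbrsIn G S v = count (λ u → adj G v u ∧ S u)

step : (G : Graph) → ℕ → VSet G → VSet G
step G k S v = S v ∨ (k ≤ᵇ nbrsIn G S v)

iter : (G : Graph) → ℕ → VSet G → ℕ → VSet G
iter G k S zero    = S
iter G k S (suc t) = step G k (iter G k S t)

IsConversionSet : (G : Graph) → ℕ → VSet G → Set
IsConversionSet G k S = ∃ λ t → ∀ v → iter G k S t v ≡ true

Ck≡ : (G : Graph) → ℕ → ℕ → Set
Ck≡ G k m =
  (Σ (VSet G) λ S → IsConversionSet G k S × count S ≡ m)
  × (∀ S → IsConversionSet G k S → m ≤ count S)

-- The double corona C_n ⊚ K_1, on vertex set Fin (3 * n).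
-- Vertex x decodes via remQuot to (layer , i) with layer 0 = v_i,
-- layer 1 = w_i, layer 2 = u_i^1 (indices i taken as 0..n-1).

succ : (n : ℕ) → Fin n → Fin n → Bool
succ n i j = (toℕ j ≡ᵇ toℕ i + 1) ∨ ((toℕ i + 1 ≡ᵇ n) ∧ (toℕ j ≡ᵇ 0))

cycAdj : (n : ℕ) → Fin n → Fin n → Bool
cycAdj n i j = succ n i j ∨ succ n j i

layerAdj : (n : ℕ) → Fin 3 → Fin n → Fin 3 → Fin n → Bool
layerAdj n f0           i f0           j = cycAdj n i j
layerAdj n (fs f0)      i (fs f0)      j = cycAdj n i j
layerAdj n f0           i (fs (fs f0)) j = toℕ i ≡ᵇ toℕ j
layerAdj n (fs f0)      i (fs (fs f0)) j = toℕ i ≡ᵇ toℕ j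
layerAdj n (fs (fs f0)) i f0           j = toℕ i ≡ᵇ toℕ j
layerAdj n (fs (fs f0)) i (fs f0)      j = toℕ i ≡ᵇ toℕ j
layerAdj n _            _ _            _ = false

CnK1adj : (n : ℕ) → Fin (3 * n) → Fin (3 * n) → Bool
CnK1adj n x y with remQuot n x | remQuot n y
... | (a , i) | (b , j) = layerAdj n a i b j

CnK1 : ℕ → Graph
CnK1 n = mkGraph (3 * n) (CnK1adj n)

{-# OPTIONS --safe #-}
-- For the k-threshold process on an undirected graph, 2k|S_t| − Σ_{v ∈ S_t} deg_{S_t}(v) never
-- increases: a vertex coloured at step t + 1 has at least k neighbours in S_t, and each such edge
-- is counted twice in the degree sum. Hence every conversion set S₀ satisfies
-- 2k|V| ≤ 2k|S₀| + 2|E|. The graph C_n ⊚ K_1 has 3n vertices and 4n edges, so for k = 2 this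
-- gives |S₀| ≥ n.
-- Conversely S₀ = {v₀, w₀} ∪ {u_i : i ≥ 2} has n elements and converts the graph: on each cycle the
-- colour runs from v_{n-1} (coloured by v₀ and u_{n-1}) down to v₂, each v_j being coloured by
-- v_{j+1} and u_j; then v₁ is coloured by v₀ and v₂, and finally u₀ and u₁ by v_i and w_i.
module Submission where

open import Defs
open import Data.Nat.Properties
open import Algebra.Properties.Semiring.Sum +-*-semiring
  using (sum; sum-syntax; sum-cong-≗; sum-remove; sum-replicate-zero; ∑-distrib-+; ∑-comm; *-distribˡ-sum)
open import Data.Bool using (Bool; true; false; _∧_; _∨_; not; if_then_else_)
open import Data.Bool.Properties using (T-≡; T-∨; T-∧; ∧-zeroʳ; ∧-identityʳ; ∨-comm; ∨-zeroʳ)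
open import Data.Empty using (⊥-elim)
open import Data.Fin using (Fin; toℕ; fromℕ<; combine; remQuot; punchIn; punchOut; _↑ˡ_; _↑ʳ_)
  renaming (zero to f0; suc to fs)
open import Data.Fin.Patterns using (0F; 1F; 2F)
open import Data.Fin.Properties
  using ( punchIn-punchOut; toℕ-injective; toℕ<n; toℕ-fromℕ<; remQuot-combine; combine-remQuot
        ; combine-injectiveˡ; combine-injectiveʳ)
  renaming (suc-injective to fs-injective)
open import Data.List using (tabulate)
open import Data.List.Properties using (map-tabulate)
open import Data.Nat
  using (ℕ; zero; suc; _+_; _*_; _∸_; _≤_; _<_; _≤′_; ≤′-refl; ≤′-step; _≤ᵇ_; _≡ᵇ_; z≤n; s≤s)
import Data.Nat.ListAction as List
open import Data.Nat.Tactic.RingSolver using (solve-∀)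
open import Data.Product using (_,_; _×_; proj₁; proj₂)
open import Data.Sum using (_⊎_; inj₁; inj₂)
open import Function using (_∘_; Equivalence)
open import Relation.Binary.PropositionalEquality
open import Relation.Nullary using (contradiction)

-- Indicators, finite sums and counting

ind : Bool → ℕ
ind b = if b then 1 else 0

ind-∨ : ∀ a b → ind (a ∨ b) ≡ ind a + ind (b ∧ not a)
ind-∨ true  b     = cong suc (sym (cong ind (∧-zeroʳ b)))
ind-∨ false true  = refl
ind-∨ false false = refl

ind-∧ : ∀ a b → ind (a ∧ b) ≡ ind a * ind b
ind-∧ true  b = sym (+-identityʳ (ind b))
ind-∧ false b = refl

∧-trueˡ : ∀ {a b} → a ∧ b ≡ true → a ≡ true
∧-trueˡ {true} _ = refl

≡⇒≡ᵇ-true : ∀ m n → m ≡ n → (m ≡ᵇ n) ≡ true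
≡⇒≡ᵇ-true m n = Equivalence.to T-≡ ∘ ≡⇒≡ᵇ m n

≡ᵇ-true⇒≡ : ∀ m n → (m ≡ᵇ n) ≡ true → m ≡ n
≡ᵇ-true⇒≡ m n = ≡ᵇ⇒≡ m n ∘ Equivalence.from T-≡

≡ᵇ-sym : ∀ m n → (m ≡ᵇ n) ≡ (n ≡ᵇ m)
≡ᵇ-sym zero    zero    = refl
≡ᵇ-sym zero    (suc n) = refl
≡ᵇ-sym (suc m) zero    = refl
≡ᵇ-sym (suc m) (suc n) = ≡ᵇ-sym m n

∑-mono-≤ : ∀ {N} {f g : Fin N → ℕ} → (∀ i → f i ≤ g i) → sum f ≤ sum g
∑-mono-≤ {zero}  f≤g = z≤n
∑-mono-≤ {suc N} f≤g = +-mono-≤ (f≤g f0) (∑-mono-≤ (f≤g ∘ fs))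

∑-const : ∀ N c → ∑[ i < N ] c ≡ N * c
∑-const zero    c = refl
∑-const (suc N) c = cong (c +_) (∑-const N c)

∑-↑ : ∀ m {n} (f : Fin (m + n) → ℕ) → sum f ≡ ∑[ i < m ] f (i ↑ˡ n) + ∑[ j < n ] f (m ↑ʳ j)
∑-↑ zero    f = refl
∑-↑ (suc m) f = trans (cong (f f0 +_) (∑-↑ m (f ∘ fs))) (sym (+-assoc (f f0) _ _))

∑-combine : ∀ m {n} (f : Fin (m * n) → ℕ) → sum f ≡ ∑[ a < m ] ∑[ i < n ] f (combine a i)
∑-combine zero        f = refl
∑-combine (suc m) {n} f =
  trans (∑-↑ n f) (cong (∑[ i < n ] f (i ↑ˡ m * n) +_) (∑-combine m (f ∘ (n ↑ʳ_))))

count≡∑ : ∀ {N} (f : Fin N → Bool) → count f ≡ ∑[ i < N ] ind (f i)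
count≡∑ f = trans (cong List.sum (map-tabulate (λ i → i) (ind ∘ f))) (listSum-tabulate (ind ∘ f))
  where
  listSum-tabulate : ∀ {M} (g : Fin M → ℕ) → List.sum (tabulate g) ≡ sum g
  listSum-tabulate {zero}  g = refl
  listSum-tabulate {suc M} g = cong (g f0 +_) (listSum-tabulate (g ∘ fs))

count-+ : ∀ {N} {f g h : Fin N → Bool} → (∀ i → ind (f i) ≡ ind (g i) + ind (h i)) →
          count f ≡ count g + count h
count-+ {f = f} {g} {h} split = begin
  count f                              ≡⟨ count≡∑ f ⟩
  sum (ind ∘ f)                        ≡⟨ sum-cong-≗ split ⟩
  ∑[ i < _ ] (ind (g i) + ind (h i))   ≡⟨ ∑-distrib-+ (ind ∘ g) (ind ∘ h) ⟩
  sum (ind ∘ g) + sum (ind ∘ h)        ≡⟨ sym (cong₂ _+_ (count≡∑ g) (count≡∑ h)) ⟩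
  count g + count h                    ∎
  where open ≡-Reasoning

count-cong : ∀ {N} {f g : Fin N → Bool} → (∀ i → f i ≡ g i) → count f ≡ count g
count-cong {f = f} {g} f≗g = trans (count≡∑ f) (trans (sum-cong-≗ (cong ind ∘ f≗g)) (sym (count≡∑ g)))

count-mono : ∀ {N} {f g : Fin N → Bool} → (∀ i → f i ≡ true → g i ≡ true) → count f ≤ count g
count-mono {f = f} {g} f⊆g =
  subst₂ _≤_ (sym (count≡∑ f)) (sym (count≡∑ g)) (∑-mono-≤ (λ i → ind-mono (f i) (g i) (f⊆g i)))
  where
  ind-mono : ∀ a b → (a ≡ true → b ≡ true) → ind a ≤ ind b
  ind-mono true  b a⇒b rewrite a⇒b refl = ≤-refl
  ind-mono false b a⇒b = z≤n

count-all : ∀ {N} {f : Fin N → Bool} → (∀ i → f i ≡ true) → count f ≡ N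
count-all {N} {f} all = begin
  count f                  ≡⟨ count-cong all ⟩
  count {N} (λ _ → true)   ≡⟨ count≡∑ {N} (λ _ → true) ⟩
  ∑[ i < N ] 1             ≡⟨ ∑-const N 1 ⟩
  N * 1                    ≡⟨ *-identityʳ N ⟩
  N                        ∎
  where open ≡-Reasoning

count-none : ∀ {N} → count {N} (λ _ → false) ≡ 0
count-none {N} = trans (count≡∑ {N} (λ _ → false)) (sum-replicate-zero N)

count-combine : ∀ m {n} (f : Fin (m * n) → Bool) → count f ≡ ∑[ a < m ] count (λ i → f (combine a i))
count-combine m {n} f =
  trans (count≡∑ f) (trans (∑-combine m (ind ∘ f))
                            (sym (sum-cong-≗ {m} λ a → count≡∑ (λ i → f (combine a i)))))

2≤count : ∀ {N} {f : Fin N → Bool} {i j} → i ≢ j → f i ≡ true → f j ≡ true → 2 ≤ count f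
2≤count {suc N} {f} {i} {j} i≢j fi fj = begin
  2                                                ≡⟨ cong₂ (λ a b → ind a + ind b) (sym fi) (sym fj) ⟩
  ind (f i) + ind (f j)                            ≡⟨ cong (λ l → ind (f i) + ind (f l)) (sym (punchIn-punchOut i≢j)) ⟩
  ind (f i) + ind (f (punchIn i k))                ≤⟨ +-monoʳ-≤ (ind (f i)) (term≤∑ (ind ∘ f ∘ punchIn i) k) ⟩
  ind (f i) + (∑[ l < N ] ind (f (punchIn i l)))   ≡⟨ sym (sum-remove (ind ∘ f)) ⟩
  sum (ind ∘ f)                                    ≡⟨ sym (count≡∑ f) ⟩
  count f                                          ∎
  where
  open ≤-Reasoning
  k : Fin N
  k = punchOut i≢j
  term≤∑ : ∀ {M} (g : Fin M → ℕ) l → g l ≤ sum g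
  term≤∑ g f0     = m≤m+n (g f0) _
  term≤∑ g (fs l) = ≤-trans (term≤∑ (g ∘ fs) l) (m≤n+m _ (g f0))

count≤1 : ∀ {N} {f : Fin N → Bool} → (∀ i j → f i ≡ true → f j ≡ true → i ≡ j) → count f ≤ 1
count≤1 {f = f} unique = subst (_≤ 1) (sym (count≡∑ f)) (∑≤1 f unique)
  where
  ∑≤1 : ∀ {M} (g : Fin M → Bool) → (∀ i j → g i ≡ true → g j ≡ true → i ≡ j) → sum (ind ∘ g) ≤ 1
  ∑≤1 {zero}  g unique = z≤n
  ∑≤1 {suc M} g unique with g f0 in g0
  ... | false = ∑≤1 (g ∘ fs) (λ i j gi gj → fs-injective (unique (fs i) (fs j) gi gj))
  ... | true  = s≤s (≤-trans (∑-mono-≤ rest-empty) (≤-reflexive (sum-replicate-zero M)))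
    where
    rest-empty : ∀ i → ind (g (fs i)) ≤ 0
    rest-empty i with g (fs i) in gi
    ... | false = z≤n
    ... | true  with () ← unique f0 (fs i) g0 gi

_∪_ _∖_ : ∀ {N} → (Fin N → Bool) → (Fin N → Bool) → Fin N → Bool
(A ∪ B) v = A v ∨ B v
(B ∖ A) v = B v ∧ not (A v)

count-∪ : ∀ {N} (A B : Fin N → Bool) → count (A ∪ B) ≡ count A + count (B ∖ A)
count-∪ A B = count-+ (λ v → ind-∨ (A v) (B v))

count-∪-≤ : ∀ {N} (A B : Fin N → Bool) → count (A ∪ B) ≤ count A + count B
count-∪-≤ A B = subst (_≤ count A + count B) (sym (count-∪ A B))
  (+-monoʳ-≤ (count A) (count-mono (λ v → ∧-trueˡ {B v} {not (A v)})))

telescope : ∀ (a b : ℕ → ℕ) → (∀ t → a (suc t) + b t ≤ a t + b (suc t)) → ∀ t → a t + b 0 ≤ a 0 + b t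
telescope a b step zero    = ≤-refl
telescope a b step (suc t) = +-cancelˡ-≤ (a t + b t) _ _ (begin
  (a t + b t) + (a (suc t) + b 0)   ≡⟨ swapˡ (a t) (b t) (a (suc t)) (b 0) ⟩
  (a (suc t) + b t) + (a t + b 0)   ≤⟨ +-mono-≤ (step t) (telescope a b step t) ⟩
  (a t + b (suc t)) + (a 0 + b t)   ≡⟨ swapʳ (a t) (b (suc t)) (a 0) (b t) ⟩
  (a t + b t) + (a 0 + b (suc t))   ∎)
  where
  open ≤-Reasoning
  swapˡ : ∀ x y z w → (x + y) + (z + w) ≡ (z + y) + (x + w)
  swapˡ = solve-∀
  swapʳ : ∀ x y z w → (x + y) + (z + w) ≡ (x + w) + (z + y)
  swapʳ = solve-∀

-- The k-threshold process on an undirected graph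

IsUndirected : Graph → Set
IsUndirected G = ∀ u v → adj G u v ≡ adj G v u

ready : (G : Graph) → ℕ → VSet G → VSet G
ready G k S v = k ≤ᵇ nbrsIn G S v

-- Ordered pairs are counted, so edgesBetween G S S is twice the number of edges inside S.
edgesBetween : (G : Graph) → VSet G → VSet G → ℕ
edgesBetween G A B = ∑[ v < order G ] (ind (A v) * nbrsIn G B v)

degreeSum : Graph → ℕ
degreeSum G = ∑[ v < order G ] count (adj G v)

step-extensive : ∀ G k (T : VSet G) x → T x ≡ true → step G k T x ≡ true
step-extensive G k T x Tx rewrite Tx = refl

step-fires : ∀ G k (T : VSet G) x → k ≤ nbrsIn G T x → step G k T x ≡ true
step-fires G k T x k≤ = trans (cong (T x ∨_) (Equivalence.to T-≡ (≤⇒≤ᵇ k≤))) (∨-zeroʳ (T x))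

step-fires-two : ∀ G (T : VSet G) x {y z} → y ≢ z → adj G x y ≡ true → adj G x z ≡ true →
                 T y ≡ true → T z ≡ true → step G 2 T x ≡ true
step-fires-two G T x y≢z xy xz Ty Tz = step-fires G 2 T x (2≤count y≢z (both xy Ty) (both xz Tz))
  where
  both : ∀ {a b} → a ≡ true → b ≡ true → a ∧ b ≡ true
  both refl refl = refl

iter-extensive : ∀ G k (S : VSet G) t x → S x ≡ true → iter G k S t x ≡ true
iter-extensive G k S zero    x Sx = Sx
iter-extensive G k S (suc t) x Sx = step-extensive G k (iter G k S t) x (iter-extensive G k S t x Sx)

iter-mono : ∀ G k (S : VSet G) {t t′} x → t ≤ t′ → iter G k S t x ≡ true → iter G k S t′ x ≡ true
iter-mono G k S x t≤t′ = go (≤⇒≤′ t≤t′)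
  where
  go : ∀ {t t′} → t ≤′ t′ → iter G k S t x ≡ true → iter G k S t′ x ≡ true
  go ≤′-refl        Xx = Xx
  go (≤′-step t≤t′) Xx = step-extensive G k _ x (go t≤t′ Xx)

module _ (G : Graph) where

  nbrsIn-∪ : ∀ A B v → nbrsIn G (A ∪ B) v ≡ nbrsIn G A v + nbrsIn G (B ∖ A) v
  nbrsIn-∪ A B v = count-+ (λ u → split (adj G v u) (A u) (B u))
    where
    split : ∀ e a b → ind (e ∧ (a ∨ b)) ≡ ind (e ∧ a) + ind (e ∧ (b ∧ not a))
    split true  a b = ind-∨ a b
    split false a b = refl

  edgesBetween-∪ˡ : ∀ A B C → edgesBetween G (A ∪ B) C ≡ edgesBetween G A C + edgesBetween G (B ∖ A) C
  edgesBetween-∪ˡ A B C = trans (sum-cong-≗ {order G} split) (∑-distrib-+ (λ v → ind (A v) * nbrsIn G C v) _)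
    where
    split : ∀ v → ind ((A ∪ B) v) * nbrsIn G C v ≡ ind (A v) * nbrsIn G C v + ind ((B ∖ A) v) * nbrsIn G C v
    split v = trans (cong (_* nbrsIn G C v) (ind-∨ (A v) (B v))) (*-distribʳ-+ (nbrsIn G C v) (ind (A v)) _)

  edgesBetween-∪ʳ : ∀ A B C → edgesBetween G C (A ∪ B) ≡ edgesBetween G C A + edgesBetween G C (B ∖ A)
  edgesBetween-∪ʳ A B C = trans (sum-cong-≗ {order G} split) (∑-distrib-+ (λ v → ind (C v) * nbrsIn G A v) _)
    where
    split : ∀ v → ind (C v) * nbrsIn G (A ∪ B) v ≡ ind (C v) * nbrsIn G A v + ind (C v) * nbrsIn G (B ∖ A) v
    split v = trans (cong (ind (C v) *_) (nbrsIn-∪ A B v)) (*-distribˡ-+ (ind (C v)) (nbrsIn G A v) _)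

  edgesBetween≡∑∑ : ∀ A B →
    edgesBetween G A B ≡ ∑[ v < order G ] ∑[ u < order G ] ind (A v ∧ (adj G v u ∧ B u))
  edgesBetween≡∑∑ A B = sum-cong-≗ {order G} λ v → begin
    ind (A v) * nbrsIn G B v                               ≡⟨ cong (ind (A v) *_) (count≡∑ (B′ v)) ⟩
    ind (A v) * (∑[ u < order G ] ind (B′ v u))            ≡⟨ *-distribˡ-sum (ind (A v)) (ind ∘ B′ v) ⟩
    ∑[ u < order G ] (ind (A v) * ind (B′ v u))            ≡⟨ sum-cong-≗ {order G} (λ u → sym (ind-∧ (A v) _)) ⟩
    ∑[ u < order G ] ind (A v ∧ (adj G v u ∧ B u))         ∎
    where
    open ≡-Reasoning
    B′ : Fin (order G) → Fin (order G) → Bool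
    B′ v u = adj G v u ∧ B u

  edgesBetween-comm : IsUndirected G → ∀ A B → edgesBetween G A B ≡ edgesBetween G B A
  edgesBetween-comm undirected A B = begin
    edgesBetween G A B
      ≡⟨ edgesBetween≡∑∑ A B ⟩
    ∑[ v < order G ] ∑[ u < order G ] ind (A v ∧ (adj G v u ∧ B u))
      ≡⟨ ∑-comm (λ v u → ind (A v ∧ (adj G v u ∧ B u))) ⟩
    ∑[ u < order G ] ∑[ v < order G ] ind (A v ∧ (adj G v u ∧ B u))
      ≡⟨ sum-cong-≗ {order G} (λ u → sum-cong-≗ {order G} λ v → cong ind (pair-sym u v)) ⟩
    ∑[ u < order G ] ∑[ v < order G ] ind (B u ∧ (adj G u v ∧ A v))
      ≡⟨ sym (edgesBetween≡∑∑ B A) ⟩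
    edgesBetween G B A
      ∎
    where
    open ≡-Reasoning
    ∧-swap : ∀ a e b → a ∧ (e ∧ b) ≡ b ∧ (e ∧ a)
    ∧-swap true  e true  = refl
    ∧-swap true  e false = ∧-zeroʳ e
    ∧-swap false e true  = sym (∧-zeroʳ e)
    ∧-swap false e false = refl
    pair-sym : ∀ u v → A v ∧ (adj G v u ∧ B u) ≡ B u ∧ (adj G u v ∧ A v)
    pair-sym u v = trans (cong (λ e → A v ∧ (e ∧ B u)) (undirected v u)) (∧-swap (A v) _ (B u))

  k*count≤edgesBetween : ∀ k A B → (∀ v → A v ≡ true → k ≤ nbrsIn G B v) → k * count A ≤ edgesBetween G A B
  k*count≤edgesBetween k A B enough = begin
    k * count A                          ≡⟨ cong (k *_) (count≡∑ A) ⟩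
    k * (∑[ v < order G ] ind (A v))     ≡⟨ *-distribˡ-sum k (λ v → ind (A v)) ⟩
    ∑[ v < order G ] (k * ind (A v))     ≤⟨ ∑-mono-≤ (λ v → pointwise (A v) (nbrsIn G B v) (enough v)) ⟩
    edgesBetween G A B                   ∎
    where
    open ≤-Reasoning
    pointwise : ∀ a d → (a ≡ true → k ≤ d) → k * ind a ≤ ind a * d
    pointwise true  d k≤d = subst₂ _≤_ (sym (*-identityʳ k)) (sym (+-identityʳ d)) (k≤d refl)
    pointwise false d _   = ≤-reflexive (*-zeroʳ k)

  edgesBetween-full : ∀ {X} → (∀ v → X v ≡ true) → edgesBetween G X X ≡ degreeSum G
  edgesBetween-full {X} full = sum-cong-≗ {order G} λ v → begin
    ind (X v) * nbrsIn G X v   ≡⟨ cong (λ b → ind b * nbrsIn G X v) (full v) ⟩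
    1 * nbrsIn G X v           ≡⟨ *-identityˡ _ ⟩
    nbrsIn G X v               ≡⟨ count-cong (λ u → trans (cong (adj G v u ∧_) (full u)) (∧-identityʳ _)) ⟩
    count (adj G v)            ∎
    where open ≡-Reasoning

module _ {G : Graph} (undirected : IsUndirected G) (k : ℕ) where

  step-potential : ∀ S → 2 * k * count (step G k S) + edgesBetween G S S
                         ≤ 2 * k * count S + edgesBetween G (step G k S) (step G k S)
  step-potential S = begin
    2 * k * count S′ + e S S                                  ≡⟨ cong (λ c → 2 * k * c + e S S) (count-∪ S R) ⟩
    2 * k * (count S + count F) + e S S                       ≡⟨ rearrange k (count S) (count F) (e S S) ⟩
    2 * k * count S + (e S S + (k * count F + k * count F))   ≤⟨ +-monoʳ-≤ (2 * k * count S)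
                                                                   (+-monoʳ-≤ (e S S) (+-mono-≤ gain gain)) ⟩
    2 * k * count S + (e S S + (e F S + e F S))               ≤⟨ +-monoʳ-≤ (2 * k * count S) growth ⟩
    2 * k * count S + e S′ S′                                 ∎
    where
    open ≤-Reasoning
    e : VSet G → VSet G → ℕ
    e = edgesBetween G
    R S′ F : VSet G
    R = ready G k S
    S′ = step G k S
    F = R ∖ S

    rearrange : ∀ k a b c → 2 * k * (a + b) + c ≡ 2 * k * a + (c + (k * b + k * b))
    rearrange = solve-∀

    gain : k * count F ≤ e F S
    gain = k*count≤edgesBetween G k F S (λ v Fv → ≤ᵇ⇒≤ k _ (Equivalence.from T-≡ (∧-trueˡ Fv)))

    growth : e S S + (e F S + e F S) ≤ e S′ S′
    growth = begin
      e S S + (e F S + e F S)             ≡⟨ sym (+-assoc (e S S) _ _) ⟩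
      (e S S + e F S) + e F S             ≤⟨ +-monoʳ-≤ (e S S + e F S) (m≤m+n (e F S) (e F F)) ⟩
      (e S S + e F S) + (e F S + e F F)   ≡⟨ cong (λ x → (e S S + x) + (e F S + e F F))
                                                   (edgesBetween-comm G undirected F S) ⟩
      (e S S + e S F) + (e F S + e F F)   ≡⟨ sym (cong₂ _+_ (edgesBetween-∪ʳ G S R S) (edgesBetween-∪ʳ G S R F)) ⟩
      e S S′ + e F S′                     ≡⟨ sym (edgesBetween-∪ˡ G S R S′) ⟩
      e S′ S′                             ∎

  iter-potential : ∀ S t → 2 * k * count (iter G k S t) + edgesBetween G S S
                           ≤ 2 * k * count S + edgesBetween G (iter G k S t) (iter G k S t)
  iter-potential S = telescope (λ t → 2 * k * count (iter G k S t))
                               (λ t → edgesBetween G (iter G k S t) (iter G k S t))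
                               (λ t → step-potential (iter G k S t))

  conversion-lower-bound : ∀ S → IsConversionSet G k S → 2 * k * order G ≤ 2 * k * count S + degreeSum G
  conversion-lower-bound S (t , full) = begin
    2 * k * order G                                                  ≡⟨ cong (2 * k *_) (sym (count-all full)) ⟩
    2 * k * count (iter G k S t)                                     ≤⟨ m≤m+n _ (edgesBetween G S S) ⟩
    2 * k * count (iter G k S t) + edgesBetween G S S                ≤⟨ iter-potential S t ⟩
    2 * k * count S + edgesBetween G (iter G k S t) (iter G k S t)   ≡⟨ cong (2 * k * count S +_)
                                                                             (edgesBetween-full G full) ⟩
    2 * k * count S + degreeSum G                                    ∎
    where open ≤-Reasoning

-- The double corona C_n ⊚ K_1

vertex : ∀ {n} → Fin 3 → Fin n → Fin (3 * n)
vertex = combine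

adj-vertex : ∀ n a (i : Fin n) b j → adj (CnK1 n) (vertex a i) (vertex b j) ≡ layerAdj n a i b j
adj-vertex n a i b j =
  cong₂ (λ p q → layerAdj n (proj₁ p) (proj₂ p) (proj₁ q) (proj₂ q)) (remQuot-combine a i) (remQuot-combine b j)

layerAdj-sym : ∀ n a (i : Fin n) b j → layerAdj n a i b j ≡ layerAdj n b j a i
layerAdj-sym n 0F i 0F j = ∨-comm (succ n i j) (succ n j i)
layerAdj-sym n 0F i 1F j = refl
layerAdj-sym n 0F i 2F j = ≡ᵇ-sym (toℕ i) (toℕ j)
layerAdj-sym n 1F i 0F j = refl
layerAdj-sym n 1F i 1F j = ∨-comm (succ n i j) (succ n j i)
layerAdj-sym n 1F i 2F j = ≡ᵇ-sym (toℕ i) (toℕ j)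
layerAdj-sym n 2F i 0F j = ≡ᵇ-sym (toℕ i) (toℕ j)
layerAdj-sym n 2F i 1F j = ≡ᵇ-sym (toℕ i) (toℕ j)
layerAdj-sym n 2F i 2F j = refl

CnK1-undirected : ∀ n → IsUndirected (CnK1 n)
CnK1-undirected n x y =
  layerAdj-sym n (proj₁ (remQuot {3} n x)) (proj₂ (remQuot {3} n x)) (proj₁ (remQuot {3} n y)) (proj₂ (remQuot {3} n y))

succ-spec : ∀ n (i j : Fin n) → succ n i j ≡ true → toℕ j ≡ toℕ i + 1 ⊎ (toℕ i + 1 ≡ n × toℕ j ≡ 0)
succ-spec n i j sij with Equivalence.to T-∨ (Equivalence.from T-≡ sij)
... | inj₁ j≡i+1 = inj₁ (≡ᵇ⇒≡ _ _ j≡i+1)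
... | inj₂ wraps with Equivalence.to T-∧ wraps
...   | i+1≡n , j≡0 = inj₂ (≡ᵇ⇒≡ _ _ i+1≡n , ≡ᵇ⇒≡ _ _ j≡0)

successor-unique : ∀ n (i j j′ : Fin n) → succ n i j ≡ true → succ n i j′ ≡ true → j ≡ j′
successor-unique n i j j′ sij sij′ with succ-spec n i j sij | succ-spec n i j′ sij′
... | inj₁ p       | inj₁ q       = toℕ-injective (trans p (sym q))
... | inj₁ p       | inj₂ (q , _) = ⊥-elim (<⇒≢ (toℕ<n j) (trans p q))
... | inj₂ (p , _) | inj₁ q       = ⊥-elim (<⇒≢ (toℕ<n j′) (trans q p))
... | inj₂ (_ , p) | inj₂ (_ , q) = toℕ-injective (trans p (sym q))

predecessor-unique : ∀ n (i j j′ : Fin n) → succ n j i ≡ true → succ n j′ i ≡ true → j ≡ j′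
predecessor-unique n i j j′ sji sj′i with succ-spec n j i sji | succ-spec n j′ i sj′i
... | inj₁ p       | inj₁ q       = toℕ-injective (+-cancelʳ-≡ 1 _ _ (trans (sym p) q))
... | inj₁ p       | inj₂ (_ , q) = ⊥-elim (m+1+n≢0 (toℕ j) (trans (sym p) q))
... | inj₂ (_ , p) | inj₁ q       = ⊥-elim (m+1+n≢0 (toℕ j′) (trans (sym q) p))
... | inj₂ (p , _) | inj₂ (q , _) = toℕ-injective (+-cancelʳ-≡ 1 _ _ (trans p (sym q)))

cycle-degree : ∀ n (i : Fin n) → count (cycAdj n i) ≤ 2
cycle-degree n i = ≤-trans (count-∪-≤ (succ n i) (λ j → succ n j i))
  (+-mono-≤ (count≤1 (successor-unique n i)) (count≤1 (predecessor-unique n i)))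

diagonal-degree : ∀ n (i : Fin n) → count {n} (λ j → toℕ i ≡ᵇ toℕ j) ≤ 1
diagonal-degree n i = count≤1 {n} {λ j → toℕ i ≡ᵇ toℕ j} λ j j′ ij ij′ →
  toℕ-injective (trans (sym (≡ᵇ-true⇒≡ (toℕ i) (toℕ j) ij)) (≡ᵇ-true⇒≡ (toℕ i) (toℕ j′) ij′))

layerDegree : Fin 3 → ℕ
layerDegree 0F = 3
layerDegree 1F = 3
layerDegree 2F = 2

degree-bound : ∀ n a i → count (adj (CnK1 n) (vertex a i)) ≤ layerDegree a
degree-bound n a i = subst (_≤ layerDegree a) (sym by-layer) (bound a)
  where
  by-layer : count (adj (CnK1 n) (vertex a i)) ≡ ∑[ b < 3 ] count (layerAdj n a i b)
  by-layer = trans (count-combine 3 {n} (adj (CnK1 n) (vertex a i)))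
                   (sum-cong-≗ {3} λ b → count-cong (adj-vertex n a i b))
  cycle : count (cycAdj n i) ≤ 2
  cycle = cycle-degree n i
  diagonal : count {n} (λ j → toℕ i ≡ᵇ toℕ j) ≤ 1
  diagonal = diagonal-degree n i
  none : count {n} (λ _ → false) ≤ 0
  none = ≤-reflexive (count-none {n})
  bound : ∀ a → ∑[ b < 3 ] count (layerAdj n a i b) ≤ layerDegree a
  bound 0F = +-mono-≤ cycle (+-mono-≤ none (+-mono-≤ diagonal z≤n))
  bound 1F = +-mono-≤ none (+-mono-≤ cycle (+-mono-≤ diagonal z≤n))
  bound 2F = +-mono-≤ diagonal (+-mono-≤ diagonal (+-mono-≤ none z≤n))

degreeSum-CnK1 : ∀ n → degreeSum (CnK1 n) ≤ 8 * n
degreeSum-CnK1 n = begin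
  degreeSum (CnK1 n)                                        ≡⟨ ∑-combine 3 {n} (count ∘ adj (CnK1 n)) ⟩
  ∑[ a < 3 ] ∑[ i < n ] count (adj (CnK1 n) (vertex a i))   ≤⟨ ∑-mono-≤ {3} (λ a → ∑-mono-≤ {n} (degree-bound n a)) ⟩
  ∑[ a < 3 ] ∑[ i < n ] layerDegree a                       ≡⟨ sum-cong-≗ {3} (λ a → ∑-const n (layerDegree a)) ⟩
  n * 3 + (n * 3 + (n * 2 + 0))                             ≡⟨ total n ⟩
  8 * n                                                     ∎
  where
  open ≤-Reasoning
  total : ∀ n → n * 3 + (n * 3 + (n * 2 + 0)) ≡ 8 * n
  total = solve-∀

CnK1-lower-bound : ∀ n S → IsConversionSet (CnK1 n) 2 S → n ≤ count S
CnK1-lower-bound n S conv = *-cancelˡ-≤ 4 (+-cancelʳ-≤ (8 * n) (4 * n) (4 * count S) (begin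
  4 * n + 8 * n                          ≡⟨ twelve n ⟩
  2 * 2 * (3 * n)                        ≤⟨ conversion-lower-bound (CnK1-undirected n) 2 S conv ⟩
  2 * 2 * count S + degreeSum (CnK1 n)   ≤⟨ +-monoʳ-≤ (4 * count S) (degreeSum-CnK1 n) ⟩
  4 * count S + 8 * n                    ∎))
  where
  open ≤-Reasoning
  twelve : ∀ n → 4 * n + 8 * n ≡ 2 * 2 * (3 * n)
  twelve = solve-∀

cycAdj-next : ∀ n (i j : Fin n) → toℕ j ≡ suc (toℕ i) → cycAdj n i j ≡ true
cycAdj-next n i j j≡1+i rewrite ≡⇒≡ᵇ-true (toℕ j) (toℕ i + 1) (trans j≡1+i (+-comm 1 (toℕ i))) = refl

cycAdj-prev : ∀ n (i j : Fin n) → toℕ i ≡ suc (toℕ j) → cycAdj n i j ≡ true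
cycAdj-prev n i j i≡1+j = trans (∨-comm (succ n i j) (succ n j i)) (cycAdj-next n j i i≡1+j)

cycAdj-wrap : ∀ n (i j : Fin n) → toℕ i + 1 ≡ n → toℕ j ≡ 0 → cycAdj n i j ≡ true
cycAdj-wrap n i j i+1≡n j≡0
  rewrite ≡⇒≡ᵇ-true (toℕ i + 1) n i+1≡n | ≡⇒≡ᵇ-true (toℕ j) 0 j≡0 | ∨-zeroʳ (toℕ j ≡ᵇ toℕ i + 1)
  = refl

seedLayer : ∀ {n} → Fin 3 → Fin n → Bool
seedLayer 0F i = toℕ i ≡ᵇ 0
seedLayer 1F i = toℕ i ≡ᵇ 0
seedLayer 2F i = 2 ≤ᵇ toℕ i

seed : ∀ n → VSet (CnK1 n)
seed n x = seedLayer (proj₁ (remQuot {3} n x)) (proj₂ (remQuot {3} n x))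

seed-vertex : ∀ n a (i : Fin n) → seed n (vertex a i) ≡ seedLayer a i
seed-vertex n a i = cong (λ p → seedLayer (proj₁ p) (proj₂ p)) (remQuot-combine a i)

count-seed : ∀ k → count (seed (3 + k)) ≡ 3 + k
count-seed k = begin
  count (seed n)                                      ≡⟨ count-combine 3 {n} (seed n) ⟩
  ∑[ a < 3 ] count {n} (λ i → seed n (vertex a i))    ≡⟨ sum-cong-≗ {3} (λ a → count-cong (seed-vertex n a)) ⟩
  ∑[ a < 3 ] count (seedLayer {n} a)                  ≡⟨ cong₂ _+_ root-count
                                                           (cong₂ _+_ root-count (cong (_+ 0) hub-count)) ⟩
  1 + (1 + (suc k + 0))                               ≡⟨ cong (2 +_) (+-identityʳ (suc k)) ⟩
  3 + k                                               ∎
  where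
  open ≡-Reasoning
  n : ℕ
  n = 3 + k
  root-count : count {n} (λ i → toℕ i ≡ᵇ 0) ≡ 1
  root-count = trans (count≡∑ {n} (λ i → toℕ i ≡ᵇ 0)) (cong suc (sum-replicate-zero (2 + k)))
  hub-count : count {n} (λ i → 2 ≤ᵇ toℕ i) ≡ suc k
  hub-count = trans (count≡∑ {n} (λ i → 2 ≤ᵇ toℕ i)) (trans (∑-const (suc k) 1) (*-identityʳ (suc k)))

data CycleLayer : Fin 3 → Set where
  v-layer : CycleLayer 0F
  w-layer : CycleLayer 1F

module Spreading (k : ℕ) where

  n : ℕ
  n = 3 + k

  X : ℕ → VSet (CnK1 n)
  X = iter (CnK1 n) 2 (seed n)

  cycle-adj : ∀ {a} → CycleLayer a → ∀ (i j : Fin n) →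
              cycAdj n i j ≡ true → adj (CnK1 n) (vertex a i) (vertex a j) ≡ true
  cycle-adj v-layer i j ij = trans (adj-vertex n 0F i 0F j) ij
  cycle-adj w-layer i j ij = trans (adj-vertex n 1F i 1F j) ij

  spoke-adj : ∀ {a} → CycleLayer a → ∀ (i : Fin n) → adj (CnK1 n) (vertex a i) (vertex 2F i) ≡ true
  spoke-adj v-layer i = trans (adj-vertex n 0F i 2F i) (≡⇒≡ᵇ-true (toℕ i) (toℕ i) refl)
  spoke-adj w-layer i = trans (adj-vertex n 1F i 2F i) (≡⇒≡ᵇ-true (toℕ i) (toℕ i) refl)

  hub-adj : ∀ {a} → CycleLayer a → ∀ (i : Fin n) → adj (CnK1 n) (vertex 2F i) (vertex a i) ≡ true
  hub-adj {a} ℓ i = trans (CnK1-undirected n (vertex 2F i) (vertex a i)) (spoke-adj ℓ i)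

  not-hub : ∀ {a} → CycleLayer a → ∀ (i j : Fin n) → vertex a i ≢ vertex 2F j
  not-hub v-layer i j eq with () ← combine-injectiveˡ {3} 0F i 2F j eq
  not-hub w-layer i j eq with () ← combine-injectiveˡ {3} 1F i 2F j eq

  root : ∀ {a} → CycleLayer a → ∀ t → X t (vertex {n} a 0F) ≡ true
  root v-layer t = iter-extensive (CnK1 n) 2 (seed n) t _ (seed-vertex n 0F 0F)
  root w-layer t = iter-extensive (CnK1 n) 2 (seed n) t _ (seed-vertex n 1F 0F)

  fire-with-spoke : ∀ {a} → CycleLayer a → ∀ t (j y : Fin n) → 2 ≤ toℕ j → cycAdj n j y ≡ true →
                    X t (vertex a y) ≡ true → X (suc t) (vertex a j) ≡ true
  fire-with-spoke ℓ t j y 2≤j jy Xy =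
    step-fires-two (CnK1 n) (X t) _ (not-hub ℓ y j) (cycle-adj ℓ j y jy) (spoke-adj ℓ j) Xy
      (iter-extensive (CnK1 n) 2 (seed n) t _ (trans (seed-vertex n 2F j) (Equivalence.to T-≡ (≤⇒≤ᵇ 2≤j))))

  reach : ∀ {a} → CycleLayer a → ∀ t (j : Fin n) → 1 ≤ toℕ j → toℕ j + t ≡ n → X t (vertex a j) ≡ true
  reach ℓ zero j _ j+0≡n = ⊥-elim (<⇒≢ (toℕ<n j) (trans (sym (+-identityʳ (toℕ j))) j+0≡n))
  reach {a} ℓ (suc t) 1F _ 1+t≡n =
    step-fires-two (CnK1 n) (X t) _ (λ eq → contradiction (combine-injectiveʳ {3} a 0F a 2F eq) λ ())
      (cycle-adj ℓ 1F 0F (cycAdj-prev n 1F 0F refl)) (cycle-adj ℓ 1F 2F (cycAdj-next n 1F 2F refl))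
      (root ℓ t) (reach ℓ t 2F (s≤s z≤n) 1+t≡n)
  reach ℓ (suc zero) j@(fs (fs _)) _ j+1≡n =
    fire-with-spoke ℓ 0 j 0F (s≤s (s≤s z≤n)) (cycAdj-wrap n j 0F j+1≡n refl) (root ℓ 0)
  reach ℓ (suc (suc t)) j@(fs (fs _)) _ j+2+t≡n =
    fire-with-spoke ℓ (suc t) j y (s≤s (s≤s z≤n)) (cycAdj-next n j y (toℕ-fromℕ< next<n))
      (reach ℓ (suc t) y (subst (1 ≤_) (sym (toℕ-fromℕ< next<n)) (s≤s z≤n)) y+1+t≡n)
    where
    next+1+t≡n : suc (toℕ j) + suc t ≡ n
    next+1+t≡n = trans (sym (+-suc (toℕ j) (suc t))) j+2+t≡n
    next<n : suc (toℕ j) < n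
    next<n = subst (suc (toℕ j) <_) next+1+t≡n (m<m+n (suc (toℕ j)) (s≤s z≤n))
    y : Fin n
    y = fromℕ< next<n
    y+1+t≡n : toℕ y + suc t ≡ n
    y+1+t≡n = trans (cong (_+ suc t) (toℕ-fromℕ< next<n)) next+1+t≡n

  layer-full : ∀ {a} → CycleLayer a → ∀ (j : Fin n) → X (2 + k) (vertex a j) ≡ true
  layer-full ℓ f0     = root ℓ (2 + k)
  layer-full ℓ (fs j) = iter-mono (CnK1 n) 2 (seed n) _ (m∸n≤m (2 + k) (toℕ j))
    (reach ℓ (n ∸ toℕ (fs j)) (fs j) (s≤s z≤n) (m+[n∸m]≡n (<⇒≤ (toℕ<n (fs j)))))

  full : ∀ a (j : Fin n) → X (3 + k) (vertex a j) ≡ true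
  full 0F j = step-extensive (CnK1 n) 2 (X (2 + k)) _ (layer-full v-layer j)
  full 1F j = step-extensive (CnK1 n) 2 (X (2 + k)) _ (layer-full w-layer j)
  full 2F j = step-fires-two (CnK1 n) (X (2 + k)) _
                (λ eq → contradiction (combine-injectiveˡ {3} 0F j 1F j eq) λ ())
                (hub-adj v-layer j) (hub-adj w-layer j) (layer-full v-layer j) (layer-full w-layer j)

  seed-converts : IsConversionSet (CnK1 n) 2 (seed n)
  seed-converts = 3 + k , λ x →
    subst (λ x → X (3 + k) x ≡ true) (combine-remQuot {3} n x)
          (full (proj₁ (remQuot {3} n x)) (proj₂ (remQuot {3} n x)))

mainTheorem5 : ∀ (n : ℕ) → 3 ≤ n → Ck≡ (CnK1 n) 2 n
mainTheorem5 (suc (suc (suc k))) (s≤s (s≤s (s≤s z≤n))) =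
  (seed (3 + k) , Spreading.seed-converts k , count-seed k) , CnK1-lower-bound (3 + k)
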